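{- Let $G=(V,E)$ be a graph, $L$ an ordered list of pairs of vertices, $v\in V$, and let $u_0=v,u_1,\ldots,u_k$ be the alternating path $\textsc{R}(L)\oplus\textsc{R}(L_{ -v})$ (with $(u_i,u_{i+1})\in\textsc{R}(L)$ for even $i$ and $(u_i,u_{i+1})\in\textsc{R}(L_{ -v})$ for odd $i$). Then: for every odd $i<k$, $u_{i+1}$ is the backup of $u_i$ with respect to $L$; for every even $i$ with $0<i<k$, $u_{i+1}$ is the backup of $u_i$ with respect to $L_{ -v}$. Moreover, if $k$ is odd then $u_k$ has no backup with respect to $L$, and if $k\ge 2$ is even then $u_k$ has no backup with respect to $L_{ -v}$.
   Context: Greedy (query-commit) matching with list $L$: go through the pairs $(a,b)\in L$ in order; if $\{a,b\}\in E$ and both $a,b$ are available, match them and mark both unavailable; $\textsc{R}(L)$ is the resulting matching. For a vertex $w$, $L_{ -w}$ denotes $L$ run with $w$ marked unavailable from the start (and $L_{ -v,-w}$ with both marked unavailable). Backup: $b$ is the backup of $u$ with respect to a list $L$ iff $u$ is matched to some vertex $w$ in $\textsc{R}(L)$ and $u$ is matched to $b$ in $\textsc{R}(L_{ -w})$; if no such $b$ exists, $u$ has no backup. The symmetric difference $\textsc{R}(L)\oplus\textsc{R}(L_{ -v})$ is always a path starting at $v$ alternating between the two matchings. -}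

module Defs where

open import Data.Nat using (ℕ)
open import Data.Fin using (Fin; _≟_)
open import Data.Bool using (Bool; true; false; not; _∧_; if_then_else_)
open import Data.List using (List; []; _∷_)
open import Data.Maybe using (Maybe; just; nothing)
open import Data.Product using (Σ; _×_; _,_; proj₁; proj₂)
open import Relation.Nullary using (¬_; yes; no)
open import Relation.Binary.PropositionalEquality using (_≡_)

record Graph (n : ℕ) : Set where
  field
    adj     : Fin n → Fin n → Bool
    adj-sym : ∀ a b → adj a b ≡ adj b a
    adj-irr : ∀ a → adj a a ≡ false
open Graph public

elem : ∀ {n} → Fin n → List (Fin n) → Bool
elem x []      = false
elem x (y ∷ ys) with x ≟ y
... | yes _ = true
... | no  _ = elem x ys

Matching : ℕ → Set
Matching n = Fin n → Maybe (Fin n)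

-- Greedy state: availability of each vertex and the current matching.
State : ℕ → Set
State n = (Fin n → Bool) × Matching n

step : ∀ {n} → Graph n → Fin n × Fin n → State n → State n
step G (a , b) (av , m) =
  if adj G a b ∧ av a ∧ av b
  then ( (λ x → if elem x (a ∷ b ∷ []) then false else av x)
       , (λ x → if elem x (a ∷ []) then just b
                else if elem x (b ∷ []) then just a else m x) )
  else (av , m)

run : ∀ {n} → Graph n → List (Fin n × Fin n) → State n → State n
run G []      s = s
run G (p ∷ L) s = run G L (step G p s)

-- R(L_{-S}) : greedy matching of L with the vertices of S unavailable
-- from the start.  R G L [] = R(L),  R G L (v ∷ []) = R(L_{-v}),
-- R G L (w ∷ v ∷ []) = R(L_{-v,-w}).
R : ∀ {n} → Graph n → List (Fin n × Fin n) → List (Fin n) → Matching n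
R G L S = proj₂ (run G L ((λ x → not (elem x S)) , (λ _ → nothing)))

InM : ∀ {n} → Matching n → Fin n → Fin n → Set
InM M x y = M x ≡ just y

data InSymDiff {n} (M₁ M₂ : Matching n) (x y : Fin n) : Set where
  left  : InM M₁ x y → ¬ InM M₂ x y → InSymDiff M₁ M₂ x y
  right : InM M₂ x y → ¬ InM M₁ x y → InSymDiff M₁ M₂ x y

Backup : ∀ {n} → Graph n → List (Fin n × Fin n) → List (Fin n) → Fin n → Fin n → Set
Backup G L S u b = Σ (Fin _) λ w → (R G L S u ≡ just w) × (R G L (w ∷ S) u ≡ just b)

NoBackup : ∀ {n} → Graph n → List (Fin n × Fin n) → List (Fin n) → Fin n → Set
NoBackup G L S u = ∀ b → ¬ Backup G L S u b

{-# OPTIONS --safe #-}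
-- Run the greedy algorithm on L and on L_{-v} side by side.  At every moment the two
-- sets of available vertices differ in exactly one vertex, the front, available in
-- only one of the runs; initially it is v = u 0.  A pair that fires in just one run
-- must contain the front x and matches it to some z, which from then on is available
-- only in the other run; the edge xz ends up in exactly one of the two final matchings,
-- so by the symmetric-difference hypothesis it is the next path edge.  Hence the front
-- walks along u 0, u 1, ..., alternating between the runs, and ends at u k, unmatched
-- in the run that holds it.
--
-- For the backups, let W be the run whose final matching contains (u j, u (j+1)) and
-- C the run that moreover starts with u j unavailable.  C shadows W until W matches
-- u j.  That cannot happen before the front reaches u j (the other run would fire the
-- same pair, putting the path edge into both final matchings), so it happens exactly
-- when the front moves on to u (j+1).  From then on C has the same available vertices
-- as the other run, so u (j+1) gets the same partner there: u (j+2), or none if j+1 = k.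

module Submission where

open import Defs
open import Data.Nat using (ℕ; zero; suc; _+_; _*_; _<_; _≤_; z≤n)
open import Data.Nat.Properties
  using (<⇒≤; ≤-refl; ≤-trans; ≤-pred; ≤∧≢⇒<; <⇒≱; <⇒≢; m<n⇒m<1+n; m≤n⇒m<n∨m≡n; *-suc)
open import Data.Fin using (Fin; _≟_)
open import Data.List using (List; []; _∷_)
open import Data.Product using (Σ; _×_; _,_; proj₁; proj₂; swap)
open import Data.Sum using (_⊎_; inj₁; inj₂)
import Data.Sum as Sum
open import Data.Bool using (Bool; true; false; not; _∧_; if_then_else_)
open import Data.Bool.Properties using (∧-zeroʳ)
open import Data.Maybe using (just; nothing)
open import Data.Maybe.Properties using (just-injective)
open import Data.Empty using (⊥; ⊥-elim)
open import Relation.Nullary using (¬_; yes; no)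
open import Relation.Binary.PropositionalEquality
open import Function using (_∘_)

Pair : ℕ → Set
Pair n = Fin n × Fin n

avail : ∀ {n} → State n → Fin n → Bool
avail = proj₁

mate : ∀ {n} → State n → Matching n
mate = proj₂

start : ∀ {n} → List (Fin n) → State n
start S = (λ x → not (elem x S)) , (λ _ → nothing)

elem-here : ∀ {n} (x : Fin n) ys → elem x (x ∷ ys) ≡ true
elem-here x ys with x ≟ x
... | yes _ = refl
... | no x≢x = ⊥-elim (x≢x refl)

elem-there : ∀ {n} {x y : Fin n} ys → x ≢ y → elem x (y ∷ ys) ≡ elem x ys
elem-there {x = x} {y} ys x≢y with x ≟ y
... | yes x≡y = ⊥-elim (x≢y x≡y)
... | no _ = refl

elem-second : ∀ {n} (a b : Fin n) → elem b (a ∷ b ∷ []) ≡ true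
elem-second a b with b ≟ a
... | yes _ = refl
... | no _ = elem-here b []

true≢false : true ≢ false
true≢false ()

pick : ∀ {A : Set} → ℕ → A → A → A
pick zero    x y = x
pick (suc t) x y = pick t y x

module _ {A : Set} where

  pick-map : ∀ {B : Set} (f : A → B) t x y → f (pick t x y) ≡ pick t (f x) (f y)
  pick-map f zero    x y = refl
  pick-map f (suc t) x y = pick-map f t y x

  pick-all : ∀ (P : A → Set) t {x y} → P x → P y → P (pick t x y)
  pick-all P zero    px py = px
  pick-all P (suc t) px py = pick-all P t py px

  pick-both : ∀ (P : A → Set) t {x y} → P (pick t x y) → P (pick t y x) → P x × P y
  pick-both P zero    p q = p , q
  pick-both P (suc t) p q = swap (pick-both P t p q)

  pick-either : ∀ t (x y : A) → pick t x y ≡ x ⊎ pick t x y ≡ y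
  pick-either t x y = pick-all (λ z → z ≡ x ⊎ z ≡ y) t (inj₁ refl) (inj₂ refl)

  pick-double : ∀ m (x y : A) → pick (2 * m) x y ≡ x
  pick-double zero    x y = refl
  pick-double (suc m) x y = trans (cong (λ t → pick t x y) (*-suc 2 m)) (pick-double m x y)

parity-induction : (P : ℕ → Set) → (∀ m → P (2 * m)) → (∀ m → P (suc (2 * m))) →
  ∀ i → P i
parity-induction P even odd zero    = even 0
parity-induction P even odd (suc i) =
  parity-induction (λ i → P (suc i)) odd (λ m → subst P (*-suc 2 m) (even (suc m))) i

symdiff-exclusive : ∀ {n} {M N : Matching n} {x y} →
  InSymDiff M N x y → InM M x y → InM N x y → ⊥
symdiff-exclusive (left _ ¬n)  _ n = ¬n n
symdiff-exclusive (right _ ¬m) m _ = ¬m m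

symdiff-swap : ∀ {n} {M N : Matching n} {x y} → InSymDiff M N x y → InSymDiff N M x y
symdiff-swap (left p q)  = right p q
symdiff-swap (right p q) = left p q

pick-symdiff : ∀ {n} t {M N : Matching n} {x y} →
  InM (pick t M N) x y → ¬ InM (pick t N M) x y → InSymDiff M N x y
pick-symdiff zero    p q = left p q
pick-symdiff (suc t) p q = symdiff-swap (pick-symdiff t p q)

record Extra {n} (x : Fin n) (S T : State n) : Set where
  field
    available   : avail S x ≡ true
    unavailable : avail T x ≡ false
    elsewhere   : ∀ {y} → y ≢ x → avail S y ≡ avail T y

open Extra public

extra-unique : ∀ {n} {x : Fin n} {S S′ T} → Extra x S T → Extra x S′ T →
  ∀ y → avail S y ≡ avail S′ y
extra-unique {x = x} E E′ y with y ≟ x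
... | yes refl = trans (available E) (sym (available E′))
... | no y≢x   = trans (elsewhere E y≢x) (sym (elsewhere E′ y≢x))

start-extra : ∀ {n} {x : Fin n} {S} → elem x S ≡ false → Extra x (start S) (start (x ∷ S))
start-extra {x = x} {S} x∉S = record
  { available   = cong not x∉S
  ; unavailable = cong not (elem-here x S)
  ; elsewhere   = λ y≢x → cong not (sym (elem-there S y≢x))
  }

module Greedy {n : ℕ} (G : Graph n) where

  fires : Pair n → State n → Bool
  fires (a , b) S = adj G a b ∧ avail S a ∧ avail S b

  matchPair : Pair n → State n → State n
  matchPair (a , b) S =
    (λ x → if elem x (a ∷ b ∷ []) then false else avail S x) ,
    (λ x → if elem x (a ∷ []) then just b else if elem x (b ∷ []) then just a else mate S x)

  data StepView (p : Pair n) (S : State n) : State n → Set where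
    fired : fires p S ≡ true  → StepView p S (matchPair p S)
    idle  : fires p S ≡ false → StepView p S S

  step-view : ∀ p S → StepView p S (step G p S)
  step-view (a , b) S with fires (a , b) S in e
  ... | true  = fired e
  ... | false = idle e

  step-fires : ∀ {p S} → fires p S ≡ true → step G p S ≡ matchPair p S
  step-fires {p} {S} e with step G p S | step-view p S
  ... | _ | fired _ = refl
  ... | _ | idle e′ = ⊥-elim (true≢false (trans (sym e) e′))

  step-idle : ∀ {p S} → fires p S ≡ false → step G p S ≡ S
  step-idle {p} {S} e with step G p S | step-view p S
  ... | _ | fired e′ = ⊥-elim (true≢false (trans (sym e′) e))
  ... | _ | idle _   = refl

  final : List (Pair n) → State n → Matching n
  final L S = mate (run G L S)

  Joins : Pair n → Fin n → Fin n → Set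
  Joins p x z = p ≡ (x , z) ⊎ p ≡ (z , x)

  joins-swap : ∀ {p x z} → Joins p x z → Joins p z x
  joins-swap = Sum.swap

  locate : ∀ x (p : Pair n) → (Σ (Fin n) λ z → Joins p x z) ⊎ (x ≢ proj₁ p × x ≢ proj₂ p)
  locate x (a , b) with x ≟ a | x ≟ b
  ... | yes refl | _        = inj₁ (b , inj₁ refl)
  ... | no _     | yes refl = inj₁ (a , inj₂ refl)
  ... | no x≢a   | no x≢b   = inj₂ (x≢a , x≢b)

  fires-ends : ∀ {a b S} → fires (a , b) S ≡ true →
    adj G a b ≡ true × avail S a ≡ true × avail S b ≡ true
  fires-ends {a} {b} {S} e with adj G a b | avail S a | avail S b
  fires-ends refl | true | true | true = refl , refl , refl

  adj-distinct : ∀ {a b} → adj G a b ≡ true → a ≢ b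
  adj-distinct {a} a~a refl = true≢false (trans (sym a~a) (adj-irr G a))

  fires-joined : ∀ {p x z S} → Joins p x z → fires p S ≡ true →
    x ≢ z × avail S x ≡ true × avail S z ≡ true
  fires-joined {S = S} (inj₁ refl) e with fires-ends {S = S} e
  ... | x~z , ax , az = adj-distinct x~z , ax , az
  fires-joined {S = S} (inj₂ refl) e with fires-ends {S = S} e
  ... | z~x , az , ax = (λ x≡z → adj-distinct z~x (sym x≡z)) , ax , az

  fires-off : ∀ {p x z S} → Joins p x z → avail S x ≡ false → fires p S ≡ false
  fires-off {x = x} {z} {S} (inj₁ refl) e rewrite e = ∧-zeroʳ (adj G x z)
  fires-off {x = x} {z} {S} (inj₂ refl) e rewrite e | ∧-zeroʳ (avail S z) = ∧-zeroʳ (adj G z x)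

  fires-cong : ∀ {a b S T} → avail S a ≡ avail T a → avail S b ≡ avail T b →
    fires (a , b) S ≡ fires (a , b) T
  fires-cong {a} {b} = cong₂ (λ s t → adj G a b ∧ s ∧ t)

  fires-cong-joined : ∀ {p x z S T} → Joins p x z →
    avail S x ≡ avail T x → avail S z ≡ avail T z → fires p S ≡ fires p T
  fires-cong-joined {S = S} {T} (inj₁ refl) ex ez = fires-cong {S = S} {T} ex ez
  fires-cong-joined {S = S} {T} (inj₂ refl) ex ez = fires-cong {S = S} {T} ez ex

  matchPair-mate : ∀ {p x z} S → Joins p x z → x ≢ z → mate (matchPair p S) x ≡ just z
  matchPair-mate {x = x} S (inj₁ refl) _ rewrite elem-here x [] = refl
  matchPair-mate {x = x} S (inj₂ refl) x≢z rewrite elem-there [] x≢z | elem-here x [] = refl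

  matchPair-taken : ∀ {p x z} S → Joins p x z → avail (matchPair p S) x ≡ false
  matchPair-taken {x = x} {z} S (inj₁ refl) rewrite elem-here x (z ∷ []) = refl
  matchPair-taken {x = x} {z} S (inj₂ refl) rewrite elem-second z x = refl

  matchPair-avail-outside : ∀ {a b y} S → y ≢ a → y ≢ b →
    avail (matchPair (a , b) S) y ≡ avail S y
  matchPair-avail-outside {b = b} S y≢a y≢b
    rewrite elem-there (b ∷ []) y≢a | elem-there [] y≢b = refl

  matchPair-mate-outside : ∀ {a b y} S → y ≢ a → y ≢ b →
    mate (matchPair (a , b) S) y ≡ mate S y
  matchPair-mate-outside S y≢a y≢b rewrite elem-there [] y≢a | elem-there [] y≢b = refl

  matchPair-avail-apart : ∀ {p x z y} S → Joins p x z → y ≢ x → y ≢ z →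
    avail (matchPair p S) y ≡ avail S y
  matchPair-avail-apart S (inj₁ refl) y≢x y≢z = matchPair-avail-outside S y≢x y≢z
  matchPair-avail-apart S (inj₂ refl) y≢x y≢z = matchPair-avail-outside S y≢z y≢x

  record Coherent (S : State n) : Set where
    field
      matched⇒unavailable : ∀ {x y} → mate S x ≡ just y → avail S x ≡ false
      mate-sym            : ∀ {x y} → mate S x ≡ just y → mate S y ≡ just x

  open Coherent public

  available⇒unmatched : ∀ {S x} → Coherent S → avail S x ≡ true → mate S x ≡ nothing
  available⇒unmatched {S} {x} coh ax with mate S x in e
  ... | nothing = refl
  ... | just y  = ⊥-elim (true≢false (trans (sym ax) (matched⇒unavailable coh e)))

  coherent-start : ∀ S → Coherent (start S)
  coherent-start S = record { matched⇒unavailable = λ () ; mate-sym = λ () }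

  unavailable-outside : ∀ {a b S y} → fires (a , b) S ≡ true → avail S y ≡ false → y ≢ a × y ≢ b
  unavailable-outside {S = S} e ay with fires-ends {S = S} e
  ... | _ , aa , ab = (λ { refl → true≢false (trans (sym aa) ay) })
                    , (λ { refl → true≢false (trans (sym ab) ay) })

  coherent-matchPair : ∀ {p S} → Coherent S → fires p S ≡ true → Coherent (matchPair p S)
  coherent-matchPair {p@(a , b)} {S} coh e =
    record { matched⇒unavailable = taken ; mate-sym = symmetric }
    where
    taken : ∀ {x y} → mate (matchPair p S) x ≡ just y → avail (matchPair p S) x ≡ false
    taken {x} m with locate x p
    ... | inj₁ (_ , j)          = matchPair-taken S j
    ... | inj₂ (x≢a , x≢b) =
      trans (matchPair-avail-outside S x≢a x≢b)
            (matched⇒unavailable coh (trans (sym (matchPair-mate-outside S x≢a x≢b)) m))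
    symmetric : ∀ {x y} → mate (matchPair p S) x ≡ just y → mate (matchPair p S) y ≡ just x
    symmetric {x} m with locate x p
    ... | inj₁ (z , j) with fires-joined {S = S} j e
    ...   | x≢z , _ with just-injective (trans (sym (matchPair-mate S j x≢z)) m)
    ...     | refl = matchPair-mate S (joins-swap j) (λ z≡x → x≢z (sym z≡x))
    symmetric {x} {y} m | inj₂ (x≢a , x≢b) =
      trans (matchPair-mate-outside S y≢a y≢b) (mate-sym coh mS)
      where
      mS : mate S x ≡ just y
      mS = trans (sym (matchPair-mate-outside S x≢a x≢b)) m
      y∉p = unavailable-outside {S = S} e (matched⇒unavailable coh (mate-sym coh mS))
      y≢a = proj₁ y∉p
      y≢b = proj₂ y∉p

  coherent-step : ∀ {p S} → Coherent S → Coherent (step G p S)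
  coherent-step {p} {S} coh with step G p S | step-view p S
  ... | _ | fired e = coherent-matchPair coh e
  ... | _ | idle _  = coh

  coherent-run : ∀ L {S} → Coherent S → Coherent (run G L S)
  coherent-run []      coh = coh
  coherent-run (p ∷ L) coh = coherent-run L (coherent-step coh)

  step-unavailable : ∀ {p S y} → avail S y ≡ false →
    avail (step G p S) y ≡ false × mate (step G p S) y ≡ mate S y
  step-unavailable {p@(a , b)} {S} {y} ay with step G p S | step-view p S
  ... | _ | idle _  = ay , refl
  ... | _ | fired e with unavailable-outside {S = S} e ay
  ...   | y≢a , y≢b =
    trans (matchPair-avail-outside S y≢a y≢b) ay , matchPair-mate-outside S y≢a y≢b

  step-avail-outside : ∀ {a b S y} → y ≢ a → y ≢ b → avail (step G (a , b) S) y ≡ avail S y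
  step-avail-outside {a} {b} {S} y≢a y≢b with step G (a , b) S | step-view (a , b) S
  ... | _ | fired _ = matchPair-avail-outside S y≢a y≢b
  ... | _ | idle _  = refl

  run-unavailable : ∀ L {S y} → avail S y ≡ false → final L S y ≡ mate S y
  run-unavailable []      ay = refl
  run-unavailable (p ∷ L) ay with step-unavailable {p} ay
  ... | ay′ , my = trans (run-unavailable L ay′) my

  run-keeps-match : ∀ L {S x y} → Coherent S → mate S x ≡ just y → final L S x ≡ just y
  run-keeps-match L coh m = trans (run-unavailable L (matched⇒unavailable coh m)) m

  run-never-matches : ∀ L {S x z} → Coherent S → avail S x ≡ false → avail S z ≡ true →
    final L S x ≢ just z
  run-never-matches L coh ax az m = true≢false (trans (sym az) (matched⇒unavailable coh z↦x))
    where z↦x = mate-sym coh (trans (sym (run-unavailable L ax)) m)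

  step-avail-cong : ∀ {p S T y} → fires p S ≡ fires p T → avail S y ≡ avail T y →
    avail (step G p S) y ≡ avail (step G p T) y
  step-avail-cong {p@(a , b)} {S} {T} {y} same e
    with step G p S | step-view p S | step G p T | step-view p T
  ... | _ | fired _ | _ | fired _ = cong (λ c → if elem y (a ∷ b ∷ []) then false else c) e
  ... | _ | idle _  | _ | idle _  = e
  ... | _ | fired s | _ | idle t  = ⊥-elim (true≢false (trans (sym s) (trans same t)))
  ... | _ | idle s  | _ | fired t = ⊥-elim (true≢false (trans (sym t) (trans (sym same) s)))

  step-mate-cong : ∀ {p S T y} → fires p S ≡ fires p T → mate S y ≡ mate T y →
    mate (step G p S) y ≡ mate (step G p T) y
  step-mate-cong {p@(a , b)} {S} {T} {y} same e
    with step G p S | step-view p S | step G p T | step-view p T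
  ... | _ | fired _ | _ | fired _ =
    cong (λ c → if elem y (a ∷ []) then just b else if elem y (b ∷ []) then just a else c) e
  ... | _ | idle _  | _ | idle _  = e
  ... | _ | fired s | _ | idle t  = ⊥-elim (true≢false (trans (sym s) (trans same t)))
  ... | _ | idle s  | _ | fired t = ⊥-elim (true≢false (trans (sym t) (trans (sym same) s)))

  run-agree : ∀ L {S T y} → (∀ x → avail S x ≡ avail T x) → mate S y ≡ mate T y →
    final L S y ≡ final L T y
  run-agree []                    same e = e
  run-agree (p@(a , b) ∷ L) {S} {T} same e =
    run-agree L (λ x → step-avail-cong {p} fires≡ (same x)) (step-mate-cong {p} fires≡ e)
    where
    fires≡ : fires p S ≡ fires p T
    fires≡ = fires-cong {a} {b} {S} {T} (same a) (same b)

  record Runs (L : List (Pair n)) (X Y : State n) (MX MY : Matching n) : Set where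
    field
      coherent₁ : Coherent X
      coherent₂ : Coherent Y
      final₁    : final L X ≡ MX
      final₂    : final L Y ≡ MY

  open Runs public

  runs-step : ∀ {p L X Y MX MY} → Runs (p ∷ L) X Y MX MY →
    Runs L (step G p X) (step G p Y) MX MY
  runs-step R = record
    { coherent₁ = coherent-step (coherent₁ R) ; coherent₂ = coherent-step (coherent₂ R)
    ; final₁ = final₁ R ; final₂ = final₂ R }

  runs-swap : ∀ {L X Y MX MY} → Runs L X Y MX MY → Runs L Y X MY MX
  runs-swap R = record
    { coherent₁ = coherent₂ R ; coherent₂ = coherent₁ R ; final₁ = final₂ R ; final₂ = final₁ R }

  record Handover (x : Fin n) (p : Pair n) (S T : State n) : Set where
    field
      partner     : Fin n
      joins       : Joins p x partner
      matched     : mate (step G p S) x ≡ just partner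
      left-behind : avail (step G p T) x ≡ false
      extra       : Extra partner (step G p T) (step G p S)

  data ExtraStep (x : Fin n) (p : Pair n) (S T : State n) : Set where
    stays : Extra x (step G p S) (step G p T) → ExtraStep x p S T
    moves : Handover x p S T → ExtraStep x p S T

  handover : ∀ {x z p S T} → Extra x S T → Joins p x z → fires p S ≡ true → fires p T ≡ false →
    Handover x p S T
  handover {x} {z} {p} {S} {T} E j s t = record
    { partner     = z
    ; joins       = j
    ; matched     = trans (cong (λ S′ → mate S′ x) (step-fires {p} {S} s)) (matchPair-mate S j x≢z)
    ; left-behind = trans (cong (λ T′ → avail T′ x) (step-idle {p} {T} t)) (unavailable E)
    ; extra       = subst₂ (Extra z) (sym (step-idle {p} {T} t)) (sym (step-fires {p} {S} s)) record
      { available   = trans (sym (elsewhere E (λ z≡x → x≢z (sym z≡x)))) az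
      ; unavailable = matchPair-taken S (joins-swap j)
      ; elsewhere   = elsewhere′
      }
    }
    where
    x≢z = proj₁ (fires-joined {S = S} j s)
    az  = proj₂ (proj₂ (fires-joined {S = S} j s))
    elsewhere′ : ∀ {y} → y ≢ z → avail T y ≡ avail (matchPair p S) y
    elsewhere′ {y} y≢z with y ≟ x
    ... | yes refl = trans (unavailable E) (sym (matchPair-taken S j))
    ... | no y≢x   = trans (sym (elsewhere E y≢x)) (sym (matchPair-avail-apart S j y≢x y≢z))

  extra-step-joined : ∀ {x z p S T} → Extra x S T → Joins p x z → ExtraStep x p S T
  extra-step-joined {x} {z} {p} {S} {T} E j with fires p S in s | fires p T in t
  ... | _     | true  = ⊥-elim (true≢false (trans (sym t) (fires-off {S = T} j (unavailable E))))
  ... | false | false =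
    stays (subst₂ (Extra x) (sym (step-idle {p} {S} s)) (sym (step-idle {p} {T} t)) E)
  ... | true  | false = moves (handover E j s t)

  extra-step : ∀ {x S T} → Extra x S T → ∀ p → ExtraStep x p S T
  extra-step {x} {S} {T} E p@(a , b) with locate x p
  ... | inj₁ (_ , j)     = extra-step-joined E j
  ... | inj₂ (x≢a , x≢b) = stays record
    { available   = trans (step-avail-outside x≢a x≢b) (available E)
    ; unavailable = proj₁ (step-unavailable {p} (unavailable E))
    ; elsewhere   = λ y≢x → step-avail-cong {p} same (elsewhere E y≢x)
    }
    where
    same : fires p S ≡ fires p T
    same = fires-cong {a} {b} {S} {T} (elsewhere E (λ a≡x → x≢a (sym a≡x)))
                                      (elsewhere E (λ b≡x → x≢b (sym b≡x)))

IsPathEdge : ∀ {n} → ℕ → (ℕ → Fin n) → Fin n → Fin n → Set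
IsPathEdge k u x y = Σ ℕ λ i → i < k × ((x ≡ u i × y ≡ u (suc i)) ⊎ (y ≡ u i × x ≡ u (suc i)))

module Alternating {n} (G : Graph n) (k : ℕ) (u : ℕ → Fin n)
  (u-injective : ∀ i j → i ≤ k → j ≤ k → u i ≡ u j → i ≡ j)
  (MA MB : Matching n)
  (symdiff⇒path : ∀ x y → InSymDiff MA MB x y → IsPathEdge k u x y)
  (path⇒symdiff : ∀ i → i < k → InSymDiff MA MB (u i) (u (suc i)))
  (path-edge : ∀ i → i < k → InM (pick i MA MB) (u i) (u (suc i)))
  where

  open Greedy G

  next-on-path : ∀ {t z} → t ≤ k → (∀ {i} → i < t → z ≢ u i) → IsPathEdge k u (u t) z →
    t < k × z ≡ u (suc t)
  next-on-path {t} t≤k fresh (i , i<k , inj₁ (ut≡ui , z≡usi))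
    with u-injective t i t≤k (<⇒≤ i<k) ut≡ui
  ... | refl = i<k , z≡usi
  next-on-path {t} t≤k fresh (i , i<k , inj₂ (z≡ui , ut≡usi))
    with u-injective t (suc i) t≤k i<k ut≡usi
  ... | refl = ⊥-elim (fresh ≤-refl z≡ui)

  Settled : ℕ → State n → Set
  Settled t S = ∀ {i} → i < t → avail S (u i) ≡ false

  settled-step : ∀ {t p S} → Settled t S → Settled t (step G p S)
  settled-step {p = p} s i<t = proj₁ (step-unavailable {p} (s i<t))

  settled-suc : ∀ {t S} → Settled t S → avail S (u t) ≡ false → Settled (suc t) S
  settled-suc s ut i<st with m≤n⇒m<n∨m≡n (≤-pred i<st)
  ... | inj₁ i<t  = s i<t
  ... | inj₂ refl = ut

  record Front (t : ℕ) (X Y : State n) : Set where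
    field
      ahead    : Extra (u t) X Y
      settled₁ : Settled t X
      settled₂ : Settled t Y

  open Front

  -- The runs are swapped each time the front moves, so the run holding u t is the one
  -- whose final matching is pick t MA MB.
  Oriented : ℕ → List (Pair n) → State n → State n → Set
  Oriented t L X Y = Runs L X Y (pick t MA MB) (pick t MB MA)

  data FrontStep (t : ℕ) (p : Pair n) (X Y : State n) : Set where
    stays : Front t (step G p X) (step G p Y) → FrontStep t p X Y
    moves : t < k → Front (suc t) (step G p Y) (step G p X) → FrontStep t p X Y

  front-step : ∀ {t p L X Y} → Oriented t (p ∷ L) X Y → t ≤ k → Front t X Y → FrontStep t p X Y
  front-step {t} {p} {L} {X} {Y} R t≤k F with extra-step (ahead F) p
  ... | stays E = stays record
    { ahead    = E
    ; settled₁ = settled-step {p = p} (settled₁ F)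
    ; settled₂ = settled-step {p = p} (settled₂ F)
    }
  ... | moves h = moves (proj₁ next) record
    { ahead    = subst (λ z → Extra z (step G p Y) (step G p X)) (proj₂ next) extra
    ; settled₁ = settled-suc {S = step G p Y} (settled-step {p = p} (settled₂ F)) left-behind
    ; settled₂ = settled-suc {S = step G p X} (settled-step {p = p} (settled₁ F))
                   (matched⇒unavailable (coherent₁ R′) matched)
    }
    where
    open Handover h
    R′ = runs-step R
    kept : InM (pick t MA MB) (u t) partner
    kept = trans (sym (cong-app (final₁ R′) (u t))) (run-keeps-match L (coherent₁ R′) matched)
    lost : ¬ InM (pick t MB MA) (u t) partner
    lost m = run-never-matches L (coherent₂ R′) left-behind (available extra)
                               (trans (cong-app (final₂ R′) (u t)) m)
    fresh : ∀ {i} → i < t → partner ≢ u i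
    fresh i<t refl =
      true≢false (trans (sym (available extra)) (settled-step {p = p} (settled₂ F) i<t))
    next = next-on-path t≤k fresh (symdiff⇒path _ _ (pick-symdiff t kept lost))

  front-unmatched : ∀ {t X Y} → Oriented t [] X Y → Front t X Y →
    pick t MA MB (u t) ≡ nothing
  front-unmatched {t} R F =
    trans (sym (cong-app (final₁ R) (u t))) (available⇒unmatched (coherent₁ R) (available (ahead F)))

  front-complete : ∀ {t X Y} → Oriented t [] X Y → t ≤ k → Front t X Y → t ≡ k
  front-complete {t} R t≤k F with m≤n⇒m<n∨m≡n t≤k
  ... | inj₂ t≡k = t≡k
  ... | inj₁ t<k with trans (sym (path-edge t t<k)) (front-unmatched R F)
  ... | ()

  front-run : ∀ L {t X Y} → Oriented t L X Y → t ≤ k → Front t X Y →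
    pick k MA MB (u k) ≡ nothing
  front-run [] R t≤k F with front-complete R t≤k F
  ... | refl = front-unmatched R F
  front-run (p ∷ L) R t≤k F with front-step R t≤k F
  ... | stays F′     = front-run L (runs-step R) t≤k F′
  ... | moves t<k F′ = front-run L (runs-swap (runs-step R)) t<k F′

  one-of : ∀ (P : State n → Set) {W X Y} → W ≡ X ⊎ W ≡ Y → P X → P Y → P W
  one-of P (inj₁ refl) px _ = px
  one-of P (inj₂ refl) _ py = py

  module _ (j : ℕ) (j<k : j < k) where

    partner-is-next : ∀ {p L W C} → Coherent W → final (p ∷ L) W ≡ pick j MA MB →
      (h : Handover (u j) p W C) → Handover.partner h ≡ u (suc j)
    partner-is-next {p} {L} {W} cohW finW h = just-injective (begin
      just partner          ≡⟨ sym (run-keeps-match L (coherent-step {p} cohW) matched) ⟩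
      final (p ∷ L) W (u j) ≡⟨ cong-app finW (u j) ⟩
      pick j MA MB (u j)    ≡⟨ path-edge j j<k ⟩
      just (u (suc j))      ∎)
      where open Handover h
            open ≡-Reasoning

    still-behind : ∀ {t X Y W} → W ≡ X ⊎ W ≡ Y → Settled (suc t) X → Settled (suc t) Y →
      avail W (u j) ≡ true → t ≢ j
    still-behind W∈ sX sY aw refl =
      true≢false (trans (sym aw) (one-of (λ S → avail S (u j) ≡ false) W∈ (sX ≤-refl) (sY ≤-refl)))

    no-early-handover : ∀ {t p L X Y W C} → t < j → Oriented t (p ∷ L) X Y →
      W ≡ X ⊎ W ≡ Y → Front t X Y → Extra (u j) W C →
      (h : Handover (u j) p W C) → Handover.partner h ≡ u (suc j) → ⊥
    no-early-handover {t} {p} {L} {X} {Y} {W} t<j R W∈ F E h refl =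
      symdiff-exclusive (path⇒symdiff j j<k) (proj₁ in-both) (proj₂ in-both)
      where
      open Handover h
      away : ∀ {i} → i ≤ k → t < i → avail X (u i) ≡ avail Y (u i)
      away i≤k t<i = elsewhere (ahead F)
        (λ e → <⇒≢ t<i (u-injective _ _ (≤-trans (<⇒≤ t<i) i≤k) i≤k (sym e)))
      agree-j  = away (<⇒≤ j<k) t<j
      agree-sj = away j<k (m<n⇒m<1+n t<j)
      same : fires p X ≡ fires p Y
      same = fires-cong-joined {S = X} {Y} joins agree-j agree-sj
      free : W ≡ X ⊎ W ≡ Y → avail X (u j) ≡ true × avail Y (u j) ≡ true
      free (inj₁ refl) = available E , trans (sym agree-j) (available E)
      free (inj₂ refl) = trans agree-j (available E) , available E
      mates-agree : mate (step G p X) (u j) ≡ mate (step G p Y) (u j)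
      mates-agree = step-mate-cong {p} same
        (trans (available⇒unmatched (coherent₁ R) (proj₁ (free W∈)))
               (sym (available⇒unmatched (coherent₂ R) (proj₂ (free W∈)))))
      both-match : W ≡ X ⊎ W ≡ Y →
        mate (step G p X) (u j) ≡ just (u (suc j)) × mate (step G p Y) (u j) ≡ just (u (suc j))
      both-match (inj₁ refl) = matched , trans (sym mates-agree) matched
      both-match (inj₂ refl) = trans mates-agree matched , matched
      R′ = runs-step R
      in-both : InM MA (u j) (u (suc j)) × InM MB (u j) (u (suc j))
      in-both = pick-both (λ M → InM M (u j) (u (suc j))) t
        (trans (sym (cong-app (final₁ R′) (u j)))
               (run-keeps-match L (coherent₁ R′) (proj₁ (both-match W∈))))
        (trans (sym (cong-app (final₂ R′) (u j)))
               (run-keeps-match L (coherent₂ R′) (proj₂ (both-match W∈))))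

    handover-at-front : ∀ {p L X Y C} → Oriented j (p ∷ L) X Y → Coherent C →
      (h : Handover (u j) p X C) → Handover.partner h ≡ u (suc j) → FrontStep j p X Y →
      final L (step G p C) (u (suc j)) ≡ pick j MB MA (u (suc j))
    handover-at-front R cohC h refl (stays F′) =
      ⊥-elim (true≢false (trans (sym (available (ahead F′)))
                                (matched⇒unavailable (coherent₁ (runs-step R)) matched)))
      where open Handover h
    handover-at-front {p} {L} {X} {Y} {C} R cohC h refl (moves _ F′) = begin
      final L (step G p C) (u (suc j)) ≡⟨ run-agree L (extra-unique extra (ahead F′)) same-mate ⟩
      final L (step G p Y) (u (suc j)) ≡⟨ cong-app (final₂ (runs-step R)) (u (suc j)) ⟩
      pick j MB MA (u (suc j))         ∎
      where
      open Handover h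
      open ≡-Reasoning
      same-mate : mate (step G p C) (u (suc j)) ≡ mate (step G p Y) (u (suc j))
      same-mate = trans (available⇒unmatched (coherent-step {p} cohC) (available extra))
                        (sym (available⇒unmatched (coherent₂ (runs-step R)) (available (ahead F′))))

    shadow-run : ∀ L {t X Y W C} → Oriented t L X Y → Coherent C → final L W ≡ pick j MA MB →
      W ≡ X ⊎ W ≡ Y → t ≤ j → Front t X Y → Extra (u j) W C →
      final L C (u (suc j)) ≡ pick j MB MA (u (suc j))
    shadow-run [] R _ _ _ t≤j F _ =
      ⊥-elim (<⇒≱ j<k (subst (_≤ j) (front-complete R (≤-trans t≤j (<⇒≤ j<k)) F) t≤j))
    shadow-run (p ∷ L) {t} {X} {Y} {W} {C} R cohC finW W∈ t≤j F E
      with front-step R (≤-trans t≤j (<⇒≤ j<k)) F | extra-step E p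
    ... | stays F′ | stays E′ =
      shadow-run L (runs-step R) (coherent-step {p} cohC) finW W∈′ t≤j F′ E′
      where W∈′ = Sum.map (cong (step G p)) (cong (step G p)) W∈
    ... | moves _ F′ | stays E′ =
      shadow-run L (runs-swap (runs-step R)) (coherent-step {p} cohC) finW W∈′
        (≤∧≢⇒< t≤j (still-behind W∈′ (settled₁ F′) (settled₂ F′) (available E′))) F′ E′
      where W∈′ = Sum.swap (Sum.map (cong (step G p)) (cong (step G p)) W∈)
    ... | FS | moves h
      with partner-is-next {p} {L} (one-of Coherent W∈ (coherent₁ R) (coherent₂ R)) finW h
         | m≤n⇒m<n∨m≡n t≤j
    ...   | next | inj₁ t<j  = ⊥-elim (no-early-handover t<j R W∈ F E h next)
    ...   | next | inj₂ refl with W∈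
    ...     | inj₁ refl = handover-at-front R cohC h next FS
    ...     | inj₂ refl = ⊥-elim (true≢false (trans (sym (available E)) (unavailable (ahead F))))

  shadow : ∀ {j L X Y C} → j < k → Runs L X Y MA MB → Front 0 X Y → Coherent C →
    Extra (u j) (pick j X Y) C → final L C (u (suc j)) ≡ pick j MB MA (u (suc j))
  shadow {j} {L} {X} {Y} j<k R F cohC E =
    shadow-run j j<k L R cohC final-picked (pick-either j X Y) z≤n F E
    where
    final-picked : final L (pick j X Y) ≡ pick j MA MB
    final-picked = trans (pick-map (final L) j X Y) (cong₂ (pick j) (final₁ R) (final₂ R))

module Backups {n} (G : Graph n) (L : List (Pair n)) (v : Fin n) (k : ℕ) (u : ℕ → Fin n)
  (u₀≡v : u 0 ≡ v)
  (u-injective : ∀ i j → i ≤ k → j ≤ k → u i ≡ u j → i ≡ j)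
  (symdiff⇒path : ∀ x y → InSymDiff (R G L []) (R G L (v ∷ [])) x y → IsPathEdge k u x y)
  (path⇒symdiff : ∀ i → i < k → InSymDiff (R G L []) (R G L (v ∷ [])) (u i) (u (suc i)))
  (path-edge : ∀ i → i < k → InM (pick i (R G L []) (R G L (v ∷ []))) (u i) (u (suc i)))
  where

  open Greedy G
  open Alternating G k u u-injective (R G L []) (R G L (v ∷ []))
                   symdiff⇒path path⇒symdiff path-edge

  side : ℕ → List (Fin n)
  side j = pick j [] (v ∷ [])

  runs₀ : Runs L (start []) (start (v ∷ [])) (R G L []) (R G L (v ∷ []))
  runs₀ = record
    { coherent₁ = coherent-start []
    ; coherent₂ = coherent-start (v ∷ [])
    ; final₁    = refl
    ; final₂    = refl
    }

  front₀ : Front 0 (start []) (start (v ∷ []))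
  front₀ = record
    { ahead    = subst (λ w → Extra (u 0) (start []) (start (w ∷ []))) u₀≡v (start-extra refl)
    ; settled₁ = λ ()
    ; settled₂ = λ ()
    }

  side-fresh : ∀ j → j ≤ k → elem (u j) (side j) ≡ false
  side-fresh zero    _    = refl
  side-fresh (suc j) sj≤k =
    pick-all (λ S → elem (u (suc j)) S ≡ false) j (elem-there [] usj≢v) refl
    where
    usj≢v : u (suc j) ≢ v
    usj≢v e with u-injective (suc j) 0 sj≤k z≤n (trans e (sym u₀≡v))
    ... | ()

  mate-before : ∀ j → j < k → R G L (side j) (u (suc j)) ≡ just (u j)
  mate-before j j<k = mate-sym (coherent-run L (coherent-start (side j)))
    (trans (cong-app (pick-map (R G L) j [] (v ∷ [])) (u j)) (path-edge j j<k))

  mate-without : ∀ j → j < k →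
    R G L (u j ∷ side j) (u (suc j)) ≡ pick (suc j) (R G L []) (R G L (v ∷ [])) (u (suc j))
  mate-without j j<k = shadow j<k runs₀ front₀ (coherent-start (u j ∷ side j))
    (subst (λ S → Extra (u j) S (start (u j ∷ side j))) (pick-map start j [] (v ∷ []))
           (start-extra (side-fresh j (<⇒≤ j<k))))

  backup-along-path : ∀ j → suc j < k → Backup G L (side j) (u (suc j)) (u (suc (suc j)))
  backup-along-path j sj<k =
    u j , mate-before j (<⇒≤ sj<k) , trans (mate-without j (<⇒≤ sj<k)) (path-edge (suc j) sj<k)

  no-backup-at-end : ∀ j → suc j ≡ k → NoBackup G L (side j) (u k)
  no-backup-at-end j refl b (w , mate-w , mate-b)
    with just-injective (trans (sym mate-w) (mate-before j ≤-refl))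
  ... | refl with trans (sym mate-b) (trans (mate-without j ≤-refl) (front-run L runs₀ z≤n front₀))
  ... | ()

lemma4p4 : ∀ {n} (G : Graph n) (L : List (Fin n × Fin n)) (v : Fin n)
    (k : ℕ) (u : ℕ → Fin n) →
    u 0 ≡ v →
    (∀ i j → i ≤ k → j ≤ k → u i ≡ u j → i ≡ j) →
    (∀ m → 2 * m < k → InM (R G L []) (u (2 * m)) (u (suc (2 * m)))) →
    (∀ m → suc (2 * m) < k → InM (R G L (v ∷ [])) (u (suc (2 * m))) (u (2 + 2 * m))) →
    (∀ x y → InSymDiff (R G L []) (R G L (v ∷ [])) x y
      → Σ ℕ λ i → i < k × ((x ≡ u i × y ≡ u (suc i)) ⊎ (y ≡ u i × x ≡ u (suc i)))) →
    (∀ i → i < k → InSymDiff (R G L []) (R G L (v ∷ [])) (u i) (u (suc i))) →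
    ((∀ m → suc (2 * m) < k → Backup G L [] (u (suc (2 * m))) (u (2 + 2 * m)))
     × (∀ m → 0 < 2 * m → 2 * m < k → Backup G L (v ∷ []) (u (2 * m)) (u (suc (2 * m))))
     × (∀ m → k ≡ suc (2 * m) → NoBackup G L [] (u k))
     × (∀ m → k ≡ 2 * m → 2 ≤ k → NoBackup G L (v ∷ []) (u k)))
lemma4p4 G L v k u u₀≡v u-injective even-edge odd-edge symdiff⇒path path⇒symdiff =
  (λ m → subst (λ S → Backup G L S _ _) (pick-double m [] (v ∷ [])) ∘ backup-along-path (2 * m)) ,
  backup-even ,
  (λ m k≡ → subst (λ S → NoBackup G L S (u k)) (pick-double m [] (v ∷ []))
                  (no-backup-at-end (2 * m) (sym k≡))) ,
  no-backup-even
  where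
  path-edge : ∀ i → i < k → InM (pick i (R G L []) (R G L (v ∷ []))) (u i) (u (suc i))
  path-edge = parity-induction _
    (λ m → subst (λ M → InM M _ _) (sym (pick-double m _ _)) ∘ even-edge m)
    (λ m → subst (λ M → InM M _ _) (sym (pick-double m _ _)) ∘ odd-edge m)

  open Backups G L v k u u₀≡v u-injective symdiff⇒path path⇒symdiff path-edge

  backup-even : ∀ m → 0 < 2 * m → 2 * m < k → Backup G L (v ∷ []) (u (2 * m)) (u (suc (2 * m)))
  backup-even zero    ()
  backup-even (suc m) _ =
    subst (λ i → i < k → Backup G L (v ∷ []) (u i) (u (suc i))) (sym (*-suc 2 m))
          (subst (λ S → Backup G L S _ _) (pick-double m (v ∷ []) []) ∘ backup-along-path (suc (2 * m)))

  no-backup-even : ∀ m → k ≡ 2 * m → 2 ≤ k → NoBackup G L (v ∷ []) (u k)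
  no-backup-even zero    refl ()
  no-backup-even (suc m) k≡ _ = subst (λ S → NoBackup G L S (u k)) (pick-double m (v ∷ []) [])
    (no-backup-at-end (suc (2 * m)) (sym (trans k≡ (*-suc 2 m))))
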